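{- If $R$ is a finite ring (associative, with nonzero identity) and $2\in U(R)$, then the unit graph $\Gamma'(R)$ is not well-covered.
   Context: $U(R)$ denotes the set of units of $R$. The unit graph $\Gamma'(R)$ has vertex set $R$, two distinct vertices $x,y$ adjacent iff $x+y\in U(R)$. A graph is well-covered if all its maximal independent sets have the same size. -}

module Defs where

open import Level using (Level; _⊔_)
open import Data.Nat using (ℕ)
open import Data.Fin using (Fin)
open import Data.List using (List; length)
open import Data.Product using (Σ; ∃; _×_)
open import Relation.Nullary using (¬_)
open import Relation.Binary using (Setoid)
open import Relation.Binary.PropositionalEquality as ≡ using (_≡_)
open import Function.Bundles using (Inverse)
open import Algebra.Bundles using (Ring)
import Data.List.Membership.Setoid as SetoidMembership
import Data.List.Relation.Unary.Unique.Setoid as SetoidUnique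

IsFinite : ∀ {c ℓ} → Setoid c ℓ → Set (c ⊔ ℓ)
IsFinite S = ∃ λ (n : ℕ) → Inverse (≡.setoid (Fin n)) S

-- Vertex sets of finite subsets are represented as duplicate-free lists
-- (duplicates measured by the setoid equality); size = length.

module GraphOn {c ℓ r} (V : Setoid c ℓ) (Adj : Setoid.Carrier V → Setoid.Carrier V → Set r) where
  open Setoid V renaming (Carrier to Vertex)
  open SetoidMembership V using (_∈_; _∉_)
  open SetoidUnique V using (Unique)

  IsIndependent : List Vertex → Set (c ⊔ ℓ ⊔ r)
  IsIndependent S = Unique S × (∀ {x y} → x ∈ S → y ∈ S → ¬ (x ≈ y) → ¬ Adj x y)

  IsMaximalIndependent : List Vertex → Set (c ⊔ ℓ ⊔ r)
  IsMaximalIndependent S =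
    IsIndependent S × (∀ x → x ∉ S → ∃ λ y → y ∈ S × Adj x y)

  WellCovered : Set (c ⊔ ℓ ⊔ r)
  WellCovered = ∀ S T → IsMaximalIndependent S → IsMaximalIndependent T →
                length S ≡ length T

module RingNotions {c ℓ} (R : Ring c ℓ) where
  open Ring R

  IsUnit : Carrier → Set (c ⊔ ℓ)
  IsUnit u = ∃ λ v → (u * v ≈ 1#) × (v * u ≈ 1#)

  UnitGraphAdj : Carrier → Carrier → Set (c ⊔ ℓ)
  UnitGraphAdj x y = ¬ (x ≈ y) × IsUnit (x + y)

  open GraphOn setoid UnitGraphAdj public using
    (IsIndependent; IsMaximalIndependent)
    renaming (WellCovered to UnitGraphWellCovered)

{-# OPTIONS --safe #-}
module Submission where

-- Negation is an automorphism of Γ'(R) that never joins x to -x (x + -x = 0 is not a unit),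
-- and since 2 is a unit its only fixed point is 0. Grow an independent set closed under
-- negation greedily, adding an uncovered vertex x together with -x; as long as 0 is
-- already covered, x ≠ -x, so the parity of the size never changes. Starting from {0}
-- and from {1, -1} (0 is adjacent to 1) gives maximal independent sets of odd and of
-- even size.

open import Defs
open import Level using (_⊔_)
open import Algebra.Bundles using (Ring)
import Algebra.Properties.Ring as RingProperties
open import Data.Nat using (parity)
import Data.Fin.Properties as Fin
open import Data.List using (List; []; _∷_; length; tabulate)
open import Data.List.Relation.Unary.Any as Any using (Any; here; there)
open import Data.List.Relation.Unary.All as All using (All; []; _∷_)
open import Data.List.Relation.Unary.All.Properties using (¬Any⇒All¬; tabulate⁻)
open import Data.List.Relation.Unary.AllPairs using ([]; _∷_)
import Data.List.Membership.Setoid as Membership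
import Data.List.Membership.Setoid.Properties as Membershipₚ
open import Data.Product using (∃; _×_; _,_; proj₂)
open import Data.Sum using (_⊎_; inj₁; inj₂; [_,_])
import Data.Sum as Sum
open import Function using (_∘_)
open import Function.Bundles using (Inverse)
open import Relation.Nullary using (¬_; Dec; yes; no; contradiction)
open import Relation.Nullary.Decidable using (_×-dec_; _⊎-dec_; ¬?)
open import Relation.Binary using (Setoid; Decidable; Symmetric; _Respects_; _Preserves_⟶_)
import Relation.Unary as Unary
open import Relation.Binary.PropositionalEquality as ≡ using (_≡_; _≢_)
import Relation.Binary.Reasoning.Setoid as SetoidReasoning

module FiniteSetoid {c ℓ} (V : Setoid c ℓ) (finite : IsFinite V) where
  open Setoid V
  private
    module I = Inverse (proj₂ finite)

  to-from : ∀ x → I.to (I.from x) ≈ x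
  to-from x = I.inverseˡ ≡.refl

  infix 4 _≟_
  _≟_ : Decidable _≈_
  x ≟ y with I.from x Fin.≟ I.from y
  ... | yes eq = yes (trans (sym (to-from x)) (trans (reflexive (≡.cong I.to eq)) (to-from y)))
  ... | no neq = no (neq ∘ I.from-cong)

  ∃? : ∀ {p} {P : Carrier → Set p} → P Respects _≈_ → Unary.Decidable P → Dec (∃ P)
  ∃? resp P? with Fin.any? (P? ∘ I.to)
  ... | yes (i , p) = yes (I.to i , p)
  ... | no ¬p = no λ (x , px) → ¬p (I.from x , resp (sym (to-from x)) px)

  enumeration : List Carrier
  enumeration = tabulate I.to

  All-enumeration⇒∀ : ∀ {p} {P : Carrier → Set p} → P Respects _≈_ →
                      All P enumeration → ∀ x → P x
  All-enumeration⇒∀ resp all x = resp (to-from x) (tabulate⁻ all (I.from x))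

module MaximalIndependentParity
  {c ℓ r} (V : Setoid c ℓ) (finite : IsFinite V)
  (Adj : Setoid.Carrier V → Setoid.Carrier V → Set r) (adj? : Decidable Adj)
  (Adj-resp : ∀ {x x′ y y′} → Setoid._≈_ V x x′ → Setoid._≈_ V y y′ → Adj x y → Adj x′ y′)
  (Adj-sym : Symmetric Adj)
  (σ : Setoid.Carrier V → Setoid.Carrier V)
  (σ-cong : σ Preserves Setoid._≈_ V ⟶ Setoid._≈_ V)
  (σ-involutive : ∀ x → Setoid._≈_ V (σ (σ x)) x)
  (Adj-σ : ∀ {x y} → Adj x y → Adj (σ x) (σ y))
  (¬Adj-σ : ∀ x → ¬ Adj x (σ x))
  where

  open Setoid V renaming (Carrier to Vertex)
  open GraphOn V Adj
  open Membership V using (_∈_; _∉_; find; lose)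
  open Membershipₚ using (∈-resp-≈)
  open FiniteSetoid V finite using (_≟_; enumeration; All-enumeration⇒∀)

  Covered : List Vertex → Vertex → Set (c ⊔ ℓ ⊔ r)
  Covered S x = x ∈ S ⊎ Any (Adj x) S

  σ-Closed : List Vertex → Set (c ⊔ ℓ)
  σ-Closed S = ∀ {x} → x ∈ S → σ x ∈ S

  Admissible : List Vertex → Set (c ⊔ ℓ ⊔ r)
  Admissible S = IsIndependent S × σ-Closed S × (∀ {x} → σ x ≈ x → Covered S x)

  covered? : ∀ S x → Dec (Covered S x)
  covered? S x = Any.any? (x ≟_) S ⊎-dec Any.any? (adj? x) S

  Covered-resp : ∀ {S} → Covered S Respects _≈_
  Covered-resp x≈y = Sum.map (∈-resp-≈ V x≈y) (Any.map (Adj-resp x≈y refl))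

  Covered-∷ : ∀ {S x y} → Covered S x → Covered (y ∷ S) x
  Covered-∷ = Sum.map there there

  independent-[] : IsIndependent []
  independent-[] = [] , λ ()

  independent-∷ : ∀ {x S} → IsIndependent S → x ∉ S → (∀ {y} → y ∈ S → ¬ Adj x y) →
                  IsIndependent (x ∷ S)
  independent-∷ {x} {S} (unique , independent) x∉S x≁S = ¬Any⇒All¬ S x∉S ∷ unique , independent′
    where
    independent′ : ∀ {a b} → a ∈ x ∷ S → b ∈ x ∷ S → ¬ a ≈ b → ¬ Adj a b
    independent′ (here a≈x)  (here b≈x)  a≉b = contradiction (trans a≈x (sym b≈x)) a≉b
    independent′ (here a≈x)  (there b∈S) _   = x≁S b∈S ∘ Adj-resp a≈x refl
    independent′ (there a∈S) (here b≈x)  _   = x≁S a∈S ∘ Adj-sym ∘ Adj-resp refl b≈x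
    independent′ (there a∈S) (there b∈S)     = independent a∈S b∈S

  independent-∷σ∷ : ∀ {x S} → IsIndependent S → σ-Closed S → ¬ Covered S x → ¬ σ x ≈ x →
                    IsIndependent (x ∷ σ x ∷ S)
  independent-∷σ∷ {x} {S} independent closed uncovered σx≉x =
    independent-∷ (independent-∷ independent σx∉S σx≁S) x∉σx∷S x≁σx∷S
    where
    x∉S : x ∉ S
    x∉S = uncovered ∘ inj₁
    x≁S : ∀ {y} → y ∈ S → ¬ Adj x y
    x≁S y∈S = uncovered ∘ inj₂ ∘ lose (Adj-resp refl) y∈S
    σx∉S : σ x ∉ S
    σx∉S = x∉S ∘ ∈-resp-≈ V (σ-involutive x) ∘ closed
    σx≁S : ∀ {y} → y ∈ S → ¬ Adj (σ x) y
    σx≁S y∈S = x≁S (closed y∈S) ∘ Adj-resp (σ-involutive x) refl ∘ Adj-σ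
    x∉σx∷S : x ∉ σ x ∷ S
    x∉σx∷S (here x≈σx) = σx≉x (sym x≈σx)
    x∉σx∷S (there x∈S) = x∉S x∈S
    x≁σx∷S : ∀ {y} → y ∈ σ x ∷ S → ¬ Adj x y
    x≁σx∷S (here y≈σx) = ¬Adj-σ x ∘ Adj-resp refl y≈σx
    x≁σx∷S (there y∈S) = x≁S y∈S

  σ-Closed-∷σ∷ : ∀ {x S} → σ-Closed S → σ-Closed (x ∷ σ x ∷ S)
  σ-Closed-∷σ∷ closed (here y≈x) = there (here (σ-cong y≈x))
  σ-Closed-∷σ∷ {x} closed (there (here y≈σx)) = here (trans (σ-cong y≈σx) (σ-involutive x))
  σ-Closed-∷σ∷ closed (there (there y∈S)) = there (there (closed y∈S))

  Admissible-∷σ∷ : ∀ {x S} → Admissible S → ¬ Covered S x → Admissible (x ∷ σ x ∷ S)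
  Admissible-∷σ∷ (independent , closed , fixed-covered) uncovered =
    independent-∷σ∷ independent closed uncovered (uncovered ∘ fixed-covered) ,
    σ-Closed-∷σ∷ closed ,
    Covered-∷ ∘ Covered-∷ ∘ fixed-covered

  extend : ∀ (L : List Vertex) {S} → Admissible S →
           ∃ λ S′ → Admissible S′ × parity (length S′) ≡ parity (length S) × All (Covered S′) L
  extend [] admissible = _ , admissible , ≡.refl , []
  extend (x ∷ L) admissible with extend L admissible
  ... | S′ , admissible′ , same-parity , covers with covered? S′ x
  ...   | yes covered  = S′ , admissible′ , same-parity , covered ∷ covers
  ...   | no uncovered = x ∷ σ x ∷ S′ , Admissible-∷σ∷ admissible′ uncovered , same-parity ,
                         inj₁ (here refl) ∷ All.map (Covered-∷ ∘ Covered-∷) covers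

  maximal-extension : ∀ {S} → Admissible S →
                      ∃ λ S′ → IsMaximalIndependent S′ × parity (length S′) ≡ parity (length S)
  maximal-extension admissible with extend enumeration admissible
  ... | S′ , (independent , _) , same-parity , covers = S′ , (independent , maximal) , same-parity
    where
    maximal : ∀ x → x ∉ S′ → ∃ λ y → y ∈ S′ × Adj x y
    maximal x x∉S′ with All-enumeration⇒∀ Covered-resp covers x
    ... | inj₁ x∈S′ = contradiction x∈S′ x∉S′
    ... | inj₂ adj  = find adj

  parity-mismatch⇒¬WellCovered : ∀ {S T} → Admissible S → Admissible T →
                                 parity (length S) ≢ parity (length T) → ¬ WellCovered
  parity-mismatch⇒¬WellCovered admissible-S admissible-T mismatch well-covered
    with maximal-extension admissible-S | maximal-extension admissible-T
  ... | S′ , maximal-S , parity-S | T′ , maximal-T , parity-T =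
    mismatch (≡.trans (≡.sym parity-S)
               (≡.trans (≡.cong parity (well-covered S′ T′ maximal-S maximal-T)) parity-T))

module UnitProperties {c ℓ} (R : Ring c ℓ) where
  open Ring R
  open RingNotions R
  open RingProperties R using (-‿distribˡ-*; -‿distribʳ-*; -‿involutive)

  -x*-y≈x*y : ∀ x y → - x * - y ≈ x * y
  -x*-y≈x*y x y = trans (sym (-‿distribˡ-* x (- y)))
                    (trans (-‿cong (sym (-‿distribʳ-* x y))) (-‿involutive (x * y)))

  IsUnit-resp : IsUnit Respects _≈_
  IsUnit-resp x≈y (v , xv≈1 , vx≈1) =
    v , trans (*-cong (sym x≈y) refl) xv≈1 , trans (*-cong refl (sym x≈y)) vx≈1

  1#-unit : IsUnit 1#
  1#-unit = 1# , *-identityˡ 1# , *-identityˡ 1#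

  -‿unit : ∀ {u} → IsUnit u → IsUnit (- u)
  -‿unit {u} (v , uv≈1 , vu≈1) = - v , trans (-x*-y≈x*y u v) uv≈1 , trans (-x*-y≈x*y v u) vu≈1

  0#-not-unit : ¬ 1# ≈ 0# → ¬ IsUnit 0#
  0#-not-unit 1≉0 (v , 0v≈1 , _) = 1≉0 (trans (sym 0v≈1) (zeroˡ v))

  IsUnit-dec : IsFinite setoid → Unary.Decidable IsUnit
  IsUnit-dec finite u = ∃? resp (λ v → (u * v ≟ 1#) ×-dec (v * u ≟ 1#))
    where
    open FiniteSetoid setoid finite using (_≟_; ∃?)
    resp : ∀ {v w} → v ≈ w → u * v ≈ 1# × v * u ≈ 1# → u * w ≈ 1# × w * u ≈ 1#
    resp v≈w (uv≈1 , vu≈1) =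
      trans (*-cong refl (sym v≈w)) uv≈1 , trans (*-cong (sym v≈w) refl) vu≈1

  x+x≈0⇒x≈0 : IsUnit (1# + 1#) → ∀ {x} → x + x ≈ 0# → x ≈ 0#
  x+x≈0⇒x≈0 (h , _ , h2≈1) {x} x+x≈0 = begin
    x                     ≈⟨ *-identityˡ x ⟨
    1# * x                ≈⟨ *-cong h2≈1 refl ⟨
    h * (1# + 1#) * x     ≈⟨ *-assoc h (1# + 1#) x ⟩
    h * ((1# + 1#) * x)   ≈⟨ *-cong refl (distribʳ x 1# 1#) ⟩
    h * (1# * x + 1# * x) ≈⟨ *-cong refl (+-cong (*-identityˡ x) (*-identityˡ x)) ⟩
    h * (x + x)           ≈⟨ *-cong refl x+x≈0 ⟩
    h * 0#                ≈⟨ zeroʳ h ⟩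
    0#                    ∎
    where open SetoidReasoning setoid

  -x≈x⇒x≈0 : IsUnit (1# + 1#) → ∀ {x} → - x ≈ x → x ≈ 0#
  -x≈x⇒x≈0 two-unit {x} -x≈x = x+x≈0⇒x≈0 two-unit (trans (+-cong refl (sym -x≈x)) (-‿inverseʳ x))

module UnitGraphProperties {c ℓ} (R : Ring c ℓ) where
  open Ring R
  open RingNotions R
  open RingProperties R using (-‿injective; -‿+-comm)
  open UnitProperties R

  UnitGraphAdj-resp : ∀ {x x′ y y′} → x ≈ x′ → y ≈ y′ → UnitGraphAdj x y → UnitGraphAdj x′ y′
  UnitGraphAdj-resp x≈x′ y≈y′ (x≉y , unit) =
    (λ x′≈y′ → x≉y (trans x≈x′ (trans x′≈y′ (sym y≈y′)))) , IsUnit-resp (+-cong x≈x′ y≈y′) unit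

  UnitGraphAdj-sym : Symmetric UnitGraphAdj
  UnitGraphAdj-sym {x} {y} (x≉y , unit) = x≉y ∘ sym , IsUnit-resp (+-comm x y) unit

  UnitGraphAdj-neg : ∀ {x y} → UnitGraphAdj x y → UnitGraphAdj (- x) (- y)
  UnitGraphAdj-neg {x} {y} (x≉y , unit) =
    x≉y ∘ -‿injective , IsUnit-resp (sym (-‿+-comm x y)) (-‿unit unit)

  ¬UnitGraphAdj-neg : ¬ 1# ≈ 0# → ∀ x → ¬ UnitGraphAdj x (- x)
  ¬UnitGraphAdj-neg 1≉0 x = 0#-not-unit 1≉0 ∘ IsUnit-resp (-‿inverseʳ x) ∘ proj₂

  UnitGraphAdj-dec : IsFinite setoid → Decidable UnitGraphAdj
  UnitGraphAdj-dec finite x y = ¬? (x ≟ y) ×-dec IsUnit-dec finite (x + y)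
    where open FiniteSetoid setoid finite using (_≟_)

module UnitGraphNegation {c ℓ} (R : Ring c ℓ) (finite : IsFinite (Ring.setoid R))
  (1≉0 : ¬ Ring._≈_ R (Ring.1# R) (Ring.0# R))
  (two-unit : RingNotions.IsUnit R (Ring._+_ R (Ring.1# R) (Ring.1# R)))
  where
  open Ring R
  open RingNotions R
  open RingProperties R using (-0#≈0#; -‿involutive)
  open UnitProperties R
  open UnitGraphProperties R

  open MaximalIndependentParity setoid finite UnitGraphAdj (UnitGraphAdj-dec finite)
    UnitGraphAdj-resp UnitGraphAdj-sym -_ -‿cong -‿involutive UnitGraphAdj-neg (¬UnitGraphAdj-neg 1≉0)
    public

  admissible-0 : Admissible (0# ∷ [])
  admissible-0 = independent-∷ independent-[] (λ ()) (λ ()) , closed , fixed-covered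
    where
    closed : σ-Closed (0# ∷ [])
    closed (here y≈0) = here (trans (-‿cong y≈0) -0#≈0#)
    fixed-covered : ∀ {x} → - x ≈ x → Covered (0# ∷ []) x
    fixed-covered -x≈x = inj₁ (here (-x≈x⇒x≈0 two-unit -x≈x))

  admissible-±1 : Admissible (1# ∷ - 1# ∷ [])
  admissible-±1 =
    independent-∷σ∷ independent-[] (λ ()) [ (λ ()) , (λ ()) ] (1≉0 ∘ -x≈x⇒x≈0 two-unit) ,
    σ-Closed-∷σ∷ (λ ()) ,
    fixed-covered
    where
    0~1 : UnitGraphAdj 0# 1#
    0~1 = 1≉0 ∘ sym , IsUnit-resp (sym (+-identityˡ 1#)) 1#-unit
    fixed-covered : ∀ {x} → - x ≈ x → Covered (1# ∷ - 1# ∷ []) x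
    fixed-covered -x≈x = inj₂ (here (UnitGraphAdj-resp (sym (-x≈x⇒x≈0 two-unit -x≈x)) refl 0~1))

proposition2p7 : ∀ {c ℓ} (R : Ring c ℓ) →
    IsFinite (Ring.setoid R) →
    ¬ (Ring._≈_ R (Ring.1# R) (Ring.0# R)) →
    RingNotions.IsUnit R (Ring._+_ R (Ring.1# R) (Ring.1# R)) →
    ¬ RingNotions.UnitGraphWellCovered R
proposition2p7 R finite 1≉0 two-unit =
  parity-mismatch⇒¬WellCovered admissible-0 admissible-±1 λ ()
  where open UnitGraphNegation R finite 1≉0 two-unit
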